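{- Let $\mathcal{L}\subseteq\mathbb{Z}^n$ be a lattice with $\mathcal{L}\cap\mathbb{N}^n=\{0\}$, let $\succ$ be a term ordering for $\mathcal{L}$, and let $G\subseteq\mathcal{L}_\succ$ be a generating set of $\mathcal{L}$. Then $G$ is a $\succ$-Gröbner basis of $\mathcal{L}$ if and only if for each pair $u,v\in G$ such that $(u,v)$ does not satisfy Criterion 2, there exists a $\succ$-reduction path between $x^{(u,v)}$ and $y^{(u,v)}$ in $\mathcal{G}(\mathcal{F}_{\mathcal{L},z^{(u,v)}},G)$.
   Context: For $b\in\mathbb{Z}^n$, $\mathcal{F}_{\mathcal{L},b}:=\{x\in\mathbb{N}^n:x\equiv b\pmod{\mathcal{L}}\}$; for $G\subseteq\mathcal{L}$, $\mathcal{G}(\mathcal{F}_{\mathcal{L},b},G)$ is the undirected graph on $\mathcal{F}_{\mathcal{L},b}$ with an edge $\{x,y\}$ whenever $x-y\in G$ or $y-x\in G$; $G$ is a generating set of $\mathcal{L}$ if all these graphs are connected. A term ordering for $\mathcal{L}$ is a relation $\succ$ that is a total well-ordering on each $\mathcal{F}_{\mathcal{L},b}$ and is additive ($x\succ y$ implies $x+\gamma\succ y+\gamma$ for $\gamma\in\mathbb{N}^n$). For $u\in\mathbb{Z}^n$, $u^+_j=\max\{u_j,0\}$, $u^-_j=\max\{ -u_j,0\}$, $\operatorname{supp}(u)=\{j:u_j\neq0\}$, and $\mathcal{L}_\succ:=\{u\in\mathcal{L}:u^+\succ u^-\}$. For $u,v\in\mathcal{L}$, $z^{(u,v)}:=\max\{u^+,v^+\}$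 (componentwise), $x^{(u,v)}:=z^{(u,v)}-u$, $y^{(u,v)}:=z^{(u,v)}-v$. A path $(x^0,\dots,x^k)$ is $\succ$-decreasing if $x^j\succ x^{j+1}$ for all $j$; it is a $\succ$-reduction path if there is no $j\in\{1,\dots,k-1\}$ with $x^j\succ x^0$ and $x^j\succ x^k$. A set $G\subseteq\mathcal{L}_\succ$ is a $\succ$-Gröbner basis of $\mathcal{L}$ if for every $x\in\mathbb{N}^n$ there is a $\succ$-decreasing path in $\mathcal{G}(\mathcal{F}_{\mathcal{L},x},G)$ from $x$ to the unique $\succ$-minimal element of $\mathcal{F}_{\mathcal{L},x}$. A pair $(u,v)$ with $u,v\in G$ satisfies Criterion 2 if there exist $x',y'\in\mathcal{F}_{\mathcal{L},z^{(u,v)}}$ such that there is a $\succ$-decreasing path in $\mathcal{G}(\mathcal{F}_{\mathcal{L},z^{(u,v)}},G)$ from $x^{(u,v)}$ to $x'$ and one from $y^{(u,v)}$ to $y'$, and $\operatorname{supp}(x')\cap\operatorname{supp}(y')\neq\emptyset$. -}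

module Defs where

open import Level using (0ℓ)
open import Data.Nat as ℕ using (ℕ; zero; suc; _∸_; _⊔_; _≤_; _<_)
open import Data.Integer as ℤ using (ℤ; +_; -[1+_])
open import Data.Fin using (Fin; zero; suc; toℕ; inject₁; fromℕ)
open import Data.Vec using (Vec; map; zipWith; replicate; lookup)
open import Data.Product using (Σ; ∃; _×_; _,_)
open import Data.Sum using (_⊎_)
open import Relation.Nullary using (¬_)
open import Relation.Binary.PropositionalEquality using (_≡_; _≢_)
open import Function.Bundles using (_⇔_)

_+ᵥ_ : ∀ {n} → Vec ℤ n → Vec ℤ n → Vec ℤ n
_+ᵥ_ = zipWith ℤ._+_

-ᵥ_ : ∀ {n} → Vec ℤ n → Vec ℤ n
-ᵥ_ = map (λ z → ℤ.- z)

_-ᵥ_ : ∀ {n} → Vec ℤ n → Vec ℤ n → Vec ℤ n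
_-ᵥ_ = zipWith ℤ._-_

toℤᵥ : ∀ {n} → Vec ℕ n → Vec ℤ n
toℤᵥ = map +_

record IsLattice {n : ℕ} (L : Vec ℤ n → Set) : Set where
  field
    zero∈ : L (replicate n (+ 0))
    +-closed : ∀ u v → L u → L v → L (u +ᵥ v)
    neg-closed : ∀ u → L u → L (-ᵥ u)

MeetsOrthantTrivially : ∀ {n} → (Vec ℤ n → Set) → Set
MeetsOrthantTrivially {n} L = ∀ (x : Vec ℕ n) → L (toℤᵥ x) → x ≡ replicate n 0

InFiber : ∀ {n} → (Vec ℤ n → Set) → Vec ℤ n → Vec ℕ n → Set
InFiber L b x = L (toℤᵥ x -ᵥ b)

record IsTermOrdering {n : ℕ} (L : Vec ℤ n → Set) (_≻_ : Vec ℕ n → Vec ℕ n → Set) : Set₁ where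
  field
    irrefl : ∀ b x → InFiber L b x → ¬ (x ≻ x)
    trans : ∀ b x y z → InFiber L b x → InFiber L b y → InFiber L b z →
            x ≻ y → y ≻ z → x ≻ z
    total : ∀ b x y → InFiber L b x → InFiber L b y → x ≢ y → (x ≻ y) ⊎ (y ≻ x)
    least : ∀ b (P : Vec ℕ n → Set) → (Σ (Vec ℕ n) λ x → InFiber L b x × P x) →
            Σ (Vec ℕ n) λ m → InFiber L b m × P m ×
              (∀ y → InFiber L b y → P y → (y ≡ m) ⊎ (y ≻ m))
    additive : ∀ x y (γ : Vec ℕ n) → x ≻ y → zipWith ℕ._+_ x γ ≻ zipWith ℕ._+_ y γ

pos : ℤ → ℕ
pos (+ m) = m
pos -[1+ m ] = 0

neg : ℤ → ℕ
neg (+ m) = 0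
neg -[1+ m ] = suc m

_⁺ : ∀ {n} → Vec ℤ n → Vec ℕ n
u ⁺ = map pos u

_⁻ : ∀ {n} → Vec ℤ n → Vec ℕ n
u ⁻ = map neg u

InL≻ : ∀ {n} → (Vec ℤ n → Set) → (Vec ℕ n → Vec ℕ n → Set) → Vec ℤ n → Set
InL≻ L _≻_ u = L u × ((u ⁺) ≻ (u ⁻))

Edge : ∀ {n} → (Vec ℤ n → Set) → Vec ℕ n → Vec ℕ n → Set
Edge G x y = G (toℤᵥ x -ᵥ toℤᵥ y) ⊎ G (toℤᵥ y -ᵥ toℤᵥ x)

record Path {n : ℕ} (L G : Vec ℤ n → Set) (b : Vec ℤ n) (x y : Vec ℕ n) : Set where
  field
    len : ℕ
    vtx : Fin (suc len) → Vec ℕ n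
    inF : ∀ j → InFiber L b (vtx j)
    adj : ∀ (j : Fin len) → Edge G (vtx (inject₁ j)) (vtx (suc j))
    start : vtx zero ≡ x
    end : vtx (fromℕ len) ≡ y

open Path public

Decreasing : ∀ {n} {L G : Vec ℤ n → Set} {b x y} →
             (Vec ℕ n → Vec ℕ n → Set) → Path L G b x y → Set
Decreasing _≻_ p = ∀ (j : Fin (len p)) → vtx p (inject₁ j) ≻ vtx p (suc j)

Reduction : ∀ {n} {L G : Vec ℤ n → Set} {b x y} →
            (Vec ℕ n → Vec ℕ n → Set) → Path L G b x y → Set
Reduction _≻_ p = ¬ (Σ (Fin (suc (len p))) λ j →
  1 ≤ toℕ j × toℕ j < len p × vtx p j ≻ vtx p zero × vtx p j ≻ vtx p (fromℕ (len p)))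

-- G is a generating set of L: every graph G(F_{L,b}, G) is connected
IsGenerating : ∀ {n} → (Vec ℤ n → Set) → (Vec ℤ n → Set) → Set
IsGenerating {n} L G = ∀ (b : Vec ℤ n) (x y : Vec ℕ n) →
  InFiber L b x → InFiber L b y → Path L G b x y

IsMinimal : ∀ {n} → (Vec ℤ n → Set) → (Vec ℕ n → Vec ℕ n → Set) → Vec ℤ n → Vec ℕ n → Set
IsMinimal {n} L _≻_ b m = InFiber L b m × (∀ y → InFiber L b y → (y ≡ m) ⊎ (y ≻ m))

IsGroebnerBasis : ∀ {n} → (Vec ℤ n → Set) → (Vec ℕ n → Vec ℕ n → Set) → (Vec ℤ n → Set) → Set
IsGroebnerBasis {n} L _≻_ G =
  (∀ u → G u → InL≻ L _≻_ u) ×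
  (∀ (x m : Vec ℕ n) → IsMinimal L _≻_ (toℤᵥ x) m →
     Σ (Path L G (toℤᵥ x) x m) λ p → Decreasing _≻_ p)

-- z^(u,v), x^(u,v) = z - u, y^(u,v) = z - v (computed in ℕ^n as z - u⁺ + u⁻)
zUV : ∀ {n} → Vec ℤ n → Vec ℤ n → Vec ℕ n
zUV u v = zipWith _⊔_ (u ⁺) (v ⁺)

xUV : ∀ {n} → Vec ℤ n → Vec ℤ n → Vec ℕ n
xUV u v = zipWith ℕ._+_ (zipWith _∸_ (zUV u v) (u ⁺)) (u ⁻)

yUV : ∀ {n} → Vec ℤ n → Vec ℤ n → Vec ℕ n
yUV u v = zipWith ℕ._+_ (zipWith _∸_ (zUV u v) (v ⁺)) (v ⁻)

SuppMeet : ∀ {n} → Vec ℕ n → Vec ℕ n → Set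
SuppMeet {n} x y = Σ (Fin n) λ j → lookup x j ≢ 0 × lookup y j ≢ 0

Criterion2 : ∀ {n} → (Vec ℤ n → Set) → (Vec ℕ n → Vec ℕ n → Set) → (Vec ℤ n → Set) →
             Vec ℤ n → Vec ℤ n → Set
Criterion2 {n} L _≻_ G u v =
  Σ (Vec ℕ n) λ x' → Σ (Vec ℕ n) λ y' →
    InFiber L (toℤᵥ (zUV u v)) x' × InFiber L (toℤᵥ (zUV u v)) y' ×
    (Σ (Path L G (toℤᵥ (zUV u v)) (xUV u v) x') λ p → Decreasing _≻_ p) ×
    (Σ (Path L G (toℤᵥ (zUV u v)) (yUV u v) y') λ q → Decreasing _≻_ q) ×
    SuppMeet x' y'

-- Forward: x^(u,v) and y^(u,v) lie in the fiber of z^(u,v) and both descend to its minimum;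
-- a path that only goes down to the minimum and back up is a reduction path.
--
-- Converse: G-moves x ⟶ x - u strictly decrease ≻. We show that every fiber is confluent,
-- i.e. any two of its elements descend to a common element; for x and the minimum m of its
-- fiber this forces x ↠ m. Since L ∩ ℕⁿ = 0, fibers are antichains and hence bounded by some
-- B ∈ ℕⁿ, and we induct on the sum of B. Inside a fiber, Newman's lemma (well-founded
-- induction on the height of a conversion) leaves local peaks c ← P → g to be joined. Such a
-- peak is the translate by γ = P - z^(u,v) of x^(u,v) ← z^(u,v) → y^(u,v). If Criterion 2
-- holds, c and g descend to elements with a common part e ≠ 0; removing e gives two elements
-- of a fiber bounded by B - e, which is confluent by induction. Otherwise the translated
-- reduction path is a conversion below max(c, g) ≺ P, joinable by the inner induction.

module Submission where

open import Defs
open import Level using (0ℓ)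
open import Axiom.ExcludedMiddle using (ExcludedMiddle)
open import Data.Nat as ℕ using (ℕ; zero; suc; _∸_; _⊔_; _⊓_; _≤_; _<_; z≤n; s≤s)
import Data.Nat.Properties as ℕP
open import Data.Nat.Induction using (<-wellFounded)
open import Data.Integer as ℤ using (ℤ; +_; -[1+_])
import Data.Integer.Properties as ℤP
open import Data.Integer.Tactic.RingSolver using (solve-∀)
open import Data.Fin using (Fin; zero; suc; toℕ; fromℕ; fromℕ<; inject₁)
import Data.Fin.Properties as FinP
open import Data.Vec using (Vec; []; _∷_; zipWith; replicate; lookup; sum; insertAt; removeAt)
import Data.Vec.Properties as VecP
open import Data.Vec.Relation.Binary.Pointwise.Inductive as Pointwise using (Pointwise; []; _∷_)
open import Data.Product using (Σ; ∃; _×_; _,_; proj₁; proj₂)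
open import Data.Sum using (_⊎_; inj₁; inj₂; swap)
open import Data.Unit using (⊤; tt)
open import Function using (id)
open import Function.Bundles using (_⇔_; mk⇔)
open import Induction.WellFounded using (module All)
import Relation.Binary.Construct.On as On
open import Relation.Binary.Construct.Closure.ReflexiveTransitive using (Star; ε; _◅_; _◅◅_; gmap; reverse)
open import Relation.Binary.PropositionalEquality
open import Relation.Nullary using (¬_; yes; no; contradiction)

infixl 6 _⊕_ _⊖_
infixl 7 _⊓ᵥ_ _⊔ᵥ_
infix 4 _≤ᵥ_

_⊕_ _⊖_ _⊓ᵥ_ _⊔ᵥ_ : ∀ {n} → Vec ℕ n → Vec ℕ n → Vec ℕ n
_⊕_ = zipWith ℕ._+_
_⊖_ = zipWith _∸_
_⊓ᵥ_ = zipWith _⊓_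
_⊔ᵥ_ = zipWith _⊔_

_≤ᵥ_ : ∀ {n} → Vec ℕ n → Vec ℕ n → Set
_≤ᵥ_ = Pointwise _≤_

≤ᵥ-trans : ∀ {n} {x y z : Vec ℕ n} → x ≤ᵥ y → y ≤ᵥ z → x ≤ᵥ z
≤ᵥ-trans = Pointwise.trans ℕP.≤-trans

⊔ᵥ-upperˡ : ∀ {n} (x y : Vec ℕ n) → x ≤ᵥ x ⊔ᵥ y
⊔ᵥ-upperˡ [] [] = []
⊔ᵥ-upperˡ (x ∷ xs) (y ∷ ys) = ℕP.m≤m⊔n x y ∷ ⊔ᵥ-upperˡ xs ys

⊔ᵥ-upperʳ : ∀ {n} (x y : Vec ℕ n) → y ≤ᵥ x ⊔ᵥ y
⊔ᵥ-upperʳ [] [] = []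
⊔ᵥ-upperʳ (x ∷ xs) (y ∷ ys) = ℕP.m≤n⊔m x y ∷ ⊔ᵥ-upperʳ xs ys

⊔ᵥ-lub : ∀ {n} {x y z : Vec ℕ n} → x ≤ᵥ z → y ≤ᵥ z → x ⊔ᵥ y ≤ᵥ z
⊔ᵥ-lub [] [] = []
⊔ᵥ-lub (x≤z ∷ xs≤zs) (y≤z ∷ ys≤zs) = ℕP.⊔-lub x≤z y≤z ∷ ⊔ᵥ-lub xs≤zs ys≤zs

⊓ᵥ-lowerˡ : ∀ {n} (x y : Vec ℕ n) → x ⊓ᵥ y ≤ᵥ x
⊓ᵥ-lowerˡ [] [] = []
⊓ᵥ-lowerˡ (x ∷ xs) (y ∷ ys) = ℕP.m⊓n≤m x y ∷ ⊓ᵥ-lowerˡ xs ys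

⊓ᵥ-lowerʳ : ∀ {n} (x y : Vec ℕ n) → x ⊓ᵥ y ≤ᵥ y
⊓ᵥ-lowerʳ [] [] = []
⊓ᵥ-lowerʳ (x ∷ xs) (y ∷ ys) = ℕP.m⊓n≤n x y ∷ ⊓ᵥ-lowerʳ xs ys

⊖-⊕-cancel : ∀ {n} {x y : Vec ℕ n} → y ≤ᵥ x → x ⊖ y ⊕ y ≡ x
⊖-⊕-cancel [] = refl
⊖-⊕-cancel (y≤x ∷ ys≤xs) = cong₂ _∷_ (ℕP.m∸n+n≡m y≤x) (⊖-⊕-cancel ys≤xs)

⊕-≤⇒≤-⊖ : ∀ {n} {x y z : Vec ℕ n} → x ⊕ y ≤ᵥ z → x ≤ᵥ z ⊖ y
⊕-≤⇒≤-⊖ {x = []} {[]} [] = []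
⊕-≤⇒≤-⊖ {x = x ∷ _} {_ ∷ _} (le ∷ les) = ℕP.m+n≤o⇒m≤o∸n x le ∷ ⊕-≤⇒≤-⊖ les

sum-⊖-≤ : ∀ {n} (x y : Vec ℕ n) → sum (x ⊖ y) ≤ sum x
sum-⊖-≤ [] [] = z≤n
sum-⊖-≤ (x ∷ xs) (y ∷ ys) = ℕP.+-mono-≤ (ℕP.m∸n≤m x y) (sum-⊖-≤ xs ys)

sum-⊖-< : ∀ {n} {x y : Vec ℕ n} → y ≤ᵥ x → ∀ j → 0 < lookup y j → sum (x ⊖ y) < sum x
sum-⊖-< {x = x ∷ xs} {y ∷ ys} (y≤x ∷ _) zero 0<y =
  ℕP.+-mono-<-≤ (ℕP.∸-monoʳ-< 0<y y≤x) (sum-⊖-≤ xs ys)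
sum-⊖-< {x = x ∷ _} {y ∷ _} (_ ∷ ys≤xs) (suc j) 0<y =
  ℕP.+-mono-≤-< (ℕP.m∸n≤m x y) (sum-⊖-< ys≤xs j 0<y)

⊖-≤ : ∀ {n} (x y : Vec ℕ n) → x ⊖ y ≤ᵥ x
⊖-≤ [] [] = []
⊖-≤ (x ∷ xs) (y ∷ ys) = ℕP.m∸n≤m x y ∷ ⊖-≤ xs ys

suppMeet-⊕ : ∀ {n} {x y : Vec ℕ n} (γ : Vec ℕ n) → SuppMeet x y → SuppMeet (x ⊕ γ) (y ⊕ γ)
suppMeet-⊕ {x = x} {y} γ (j , xⱼ≢0 , yⱼ≢0) = j , grow x xⱼ≢0 , grow y yⱼ≢0
  where
  grow : ∀ w → lookup w j ≢ 0 → lookup (w ⊕ γ) j ≢ 0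
  grow w wⱼ≢0 eq = wⱼ≢0 (ℕP.m+n≡0⇒m≡0 (lookup w j) (trans (sym (VecP.lookup-zipWith ℕ._+_ j w γ)) eq))

+-∸ : ∀ {m n} → n ≤ m → + (m ∸ n) ≡ + m ℤ.- + n
+-∸ {m} {n} n≤m = trans (sym (ℤP.⊖-≥ n≤m)) (sym (ℤP.m-n≡m⊖n m n))

pos-⊖ : ∀ m n → pos (m ℤ.⊖ n) ≡ m ∸ n
pos-⊖ zero zero = refl
pos-⊖ zero (suc n) = refl
pos-⊖ (suc m) zero = refl
pos-⊖ (suc m) (suc n) = trans (cong pos (ℤP.[1+m]⊖[1+n]≡m⊖n m n)) (pos-⊖ m n)

neg-⊖ : ∀ m n → neg (m ℤ.⊖ n) ≡ n ∸ m
neg-⊖ zero zero = refl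
neg-⊖ zero (suc n) = refl
neg-⊖ (suc m) zero = refl
neg-⊖ (suc m) (suc n) = trans (cong neg (ℤP.[1+m]⊖[1+n]≡m⊖n m n)) (neg-⊖ m n)

toℤᵥ-⊕ : ∀ {n} (x y : Vec ℕ n) → toℤᵥ (x ⊕ y) ≡ toℤᵥ x +ᵥ toℤᵥ y
toℤᵥ-⊕ [] [] = refl
toℤᵥ-⊕ (x ∷ xs) (y ∷ ys) = cong₂ _∷_ (ℤP.pos-+ x y) (toℤᵥ-⊕ xs ys)

toℤᵥ-⊖ : ∀ {n} {x y : Vec ℕ n} → y ≤ᵥ x → toℤᵥ (x ⊖ y) ≡ toℤᵥ x -ᵥ toℤᵥ y
toℤᵥ-⊖ [] = refl
toℤᵥ-⊖ (y≤x ∷ ys≤xs) = cong₂ _∷_ (+-∸ y≤x) (toℤᵥ-⊖ ys≤xs)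

toℤᵥ-injective : ∀ {n} {x y : Vec ℕ n} → toℤᵥ x ≡ toℤᵥ y → x ≡ y
toℤᵥ-injective {x = []} {[]} _ = refl
toℤᵥ-injective {x = _ ∷ _} {_ ∷ _} eq =
  cong₂ _∷_ (ℤP.+-injective (VecP.∷-injectiveˡ eq)) (toℤᵥ-injective (VecP.∷-injectiveʳ eq))

⁺-toℤᵥ-difference : ∀ {n} (x y : Vec ℕ n) → (toℤᵥ x -ᵥ toℤᵥ y) ⁺ ≡ x ⊖ y
⁺-toℤᵥ-difference [] [] = refl
⁺-toℤᵥ-difference (x ∷ xs) (y ∷ ys) =
  cong₂ _∷_ (trans (cong pos (ℤP.m-n≡m⊖n x y)) (pos-⊖ x y)) (⁺-toℤᵥ-difference xs ys)

⁻-toℤᵥ-difference : ∀ {n} (x y : Vec ℕ n) → (toℤᵥ x -ᵥ toℤᵥ y) ⁻ ≡ y ⊖ x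
⁻-toℤᵥ-difference [] [] = refl
⁻-toℤᵥ-difference (x ∷ xs) (y ∷ ys) =
  cong₂ _∷_ (trans (cong neg (ℤP.m-n≡m⊖n x y)) (neg-⊖ x y)) (⁻-toℤᵥ-difference xs ys)

⊖-⊕-⊓ᵥˡ : ∀ {n} (x y : Vec ℕ n) → x ⊖ y ⊕ x ⊓ᵥ y ≡ x
⊖-⊕-⊓ᵥˡ [] [] = refl
⊖-⊕-⊓ᵥˡ (x ∷ xs) (y ∷ ys) = cong₂ _∷_ head (⊖-⊕-⊓ᵥˡ xs ys)
  where
  head : x ∸ y ℕ.+ x ⊓ y ≡ x
  head = trans (cong₂ ℕ._+_ refl (ℕP.⊓-comm x y))
               (trans (ℕP.+-comm (x ∸ y) (y ⊓ x)) (ℕP.m⊓n+n∸m≡n y x))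

⊖-⊕-⊓ᵥʳ : ∀ {n} (x y : Vec ℕ n) → y ⊖ x ⊕ x ⊓ᵥ y ≡ y
⊖-⊕-⊓ᵥʳ [] [] = refl
⊖-⊕-⊓ᵥʳ (x ∷ xs) (y ∷ ys) =
  cong₂ _∷_ (trans (ℕP.+-comm (y ∸ x) (x ⊓ y)) (ℕP.m⊓n+n∸m≡n x y)) (⊖-⊕-⊓ᵥʳ xs ys)

-- (z ∸ u⁺) + u⁻ is how xUV and yUV encode z - u in ℕⁿ; it is exact once u⁺ ≤ z.
toℤᵥ-[⊖⁺]⊕⁻ : ∀ {n} (u : Vec ℤ n) {z : Vec ℕ n} → u ⁺ ≤ᵥ z → toℤᵥ (z ⊖ u ⁺ ⊕ u ⁻) ≡ toℤᵥ z -ᵥ u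
toℤᵥ-[⊖⁺]⊕⁻ [] [] = refl
toℤᵥ-[⊖⁺]⊕⁻ (u ∷ us) {z ∷ _} (u⁺≤z ∷ us⁺≤zs) = cong₂ _∷_ head (toℤᵥ-[⊖⁺]⊕⁻ us us⁺≤zs)
  where
  pos-minus-neg : ∀ w → + pos w ℤ.- + neg w ≡ w
  pos-minus-neg (+ m) = cong +_ (ℕP.+-identityʳ m)
  pos-minus-neg -[1+ m ] = refl
  regroup : ∀ (a b c : ℤ) → (a ℤ.- b) ℤ.+ c ≡ a ℤ.- (b ℤ.- c)
  regroup = solve-∀
  head : + (z ∸ pos u ℕ.+ neg u) ≡ + z ℤ.- u
  head = begin
    + (z ∸ pos u ℕ.+ neg u)            ≡⟨ ℤP.pos-+ (z ∸ pos u) (neg u) ⟩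
    + (z ∸ pos u) ℤ.+ + neg u          ≡⟨ cong (ℤ._+ + neg u) (+-∸ u⁺≤z) ⟩
    (+ z ℤ.- + pos u) ℤ.+ + neg u      ≡⟨ regroup (+ z) (+ pos u) (+ neg u) ⟩
    + z ℤ.- (+ pos u ℤ.- + neg u)      ≡⟨ cong (ℤ._-_ (+ z)) (pos-minus-neg u) ⟩
    + z ℤ.- u                          ∎
    where open ≡-Reasoning

toℤᵥ-xUV : ∀ {n} (u v : Vec ℤ n) → toℤᵥ (xUV u v) ≡ toℤᵥ (zUV u v) -ᵥ u
toℤᵥ-xUV u v = toℤᵥ-[⊖⁺]⊕⁻ u (⊔ᵥ-upperˡ (u ⁺) (v ⁺))

toℤᵥ-yUV : ∀ {n} (u v : Vec ℤ n) → toℤᵥ (yUV u v) ≡ toℤᵥ (zUV u v) -ᵥ v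
toℤᵥ-yUV u v = toℤᵥ-[⊖⁺]⊕⁻ v (⊔ᵥ-upperʳ (u ⁺) (v ⁺))

-ᵥ-self : ∀ {n} (u : Vec ℤ n) → u -ᵥ u ≡ replicate n (+ 0)
-ᵥ-self [] = refl
-ᵥ-self (a ∷ u) = cong₂ _∷_ (ℤP.+-inverseʳ a) (-ᵥ-self u)

-ᵥ-anticomm : ∀ {n} (u v : Vec ℤ n) → -ᵥ (u -ᵥ v) ≡ v -ᵥ u
-ᵥ-anticomm [] [] = refl
-ᵥ-anticomm (a ∷ u) (b ∷ v) = cong₂ _∷_ (scalar a b) (-ᵥ-anticomm u v)
  where
  scalar : ∀ (a b : ℤ) → ℤ.- (a ℤ.- b) ≡ b ℤ.- a
  scalar = solve-∀

-ᵥ-telescope : ∀ {n} (u v w : Vec ℤ n) → (u -ᵥ v) +ᵥ (v -ᵥ w) ≡ u -ᵥ w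
-ᵥ-telescope [] [] [] = refl
-ᵥ-telescope (a ∷ u) (b ∷ v) (c ∷ w) = cong₂ _∷_ (scalar a b c) (-ᵥ-telescope u v w)
  where
  scalar : ∀ (a b c : ℤ) → (a ℤ.- b) ℤ.+ (b ℤ.- c) ≡ a ℤ.- c
  scalar = solve-∀

-ᵥ-involutive : ∀ {n} (u w : Vec ℤ n) → u -ᵥ (u -ᵥ w) ≡ w
-ᵥ-involutive [] [] = refl
-ᵥ-involutive (a ∷ u) (c ∷ w) = cong₂ _∷_ (scalar a c) (-ᵥ-involutive u w)
  where
  scalar : ∀ (a c : ℤ) → a ℤ.- (a ℤ.- c) ≡ c
  scalar = solve-∀

-ᵥ-+ᵥ-regroup : ∀ {n} (z p c : Vec ℤ n) → (z -ᵥ (p -ᵥ c)) +ᵥ (p -ᵥ z) ≡ c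
-ᵥ-+ᵥ-regroup [] [] [] = refl
-ᵥ-+ᵥ-regroup (a ∷ z) (b ∷ p) (c ∷ w) = cong₂ _∷_ (scalar a b c) (-ᵥ-+ᵥ-regroup z p w)
  where
  scalar : ∀ (a b c : ℤ) → (a ℤ.- (b ℤ.- c)) ℤ.+ (b ℤ.- a) ≡ c
  scalar = solve-∀

toℤᵥ-⊕-difference : ∀ {n} (x y γ : Vec ℕ n) → toℤᵥ (x ⊕ γ) -ᵥ toℤᵥ (y ⊕ γ) ≡ toℤᵥ x -ᵥ toℤᵥ y
toℤᵥ-⊕-difference [] [] [] = refl
toℤᵥ-⊕-difference (x ∷ xs) (y ∷ ys) (g ∷ gs) = cong₂ _∷_ head (toℤᵥ-⊕-difference xs ys gs)
  where
  cancel : ∀ (a b c : ℤ) → (a ℤ.+ c) ℤ.- (b ℤ.+ c) ≡ a ℤ.- b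
  cancel = solve-∀
  head : + (x ℕ.+ g) ℤ.- + (y ℕ.+ g) ≡ + x ℤ.- + y
  head rewrite ℤP.pos-+ x g | ℤP.pos-+ y g = cancel (+ x) (+ y) (+ g)

Antichain : ∀ {n} → (Vec ℕ n → Set) → Set
Antichain S = ∀ {a a'} → S a → S a' → a ≤ᵥ a' → a ≡ a'

≰ᵥ⇒∃> : ∀ {n} {x y : Vec ℕ n} → ¬ x ≤ᵥ y → ∃ λ i → lookup y i < lookup x i
≰ᵥ⇒∃> {x = []} {[]} x≰y = contradiction [] x≰y
≰ᵥ⇒∃> {x = x ∷ _} {y ∷ _} x≰y with x ℕP.≤? y
... | no x₀≰y₀ = zero , ℕP.≰⇒> x₀≰y₀
... | yes x₀≤y₀ with ≰ᵥ⇒∃> (λ xs≤ys → x≰y (x₀≤y₀ ∷ xs≤ys))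
...   | i , yᵢ<xᵢ = suc i , yᵢ<xᵢ

insertAt-mono : ∀ {n} {x y : Vec ℕ n} i k → x ≤ᵥ y → insertAt x i k ≤ᵥ insertAt y i k
insertAt-mono zero k x≤y = ℕP.≤-refl ∷ x≤y
insertAt-mono {x = _ ∷ _} {_ ∷ _} (suc i) k (x₀≤y₀ ∷ xs≤ys) = x₀≤y₀ ∷ insertAt-mono i k xs≤ys

⨆ : ∀ {n m} → (Fin m → Vec ℕ n) → Vec ℕ n
⨆ {n} {zero} f = replicate n 0
⨆ {m = suc m} f = f zero ⊔ᵥ ⨆ (λ i → f (suc i))

≤-⨆ : ∀ {n m} (f : Fin m → Vec ℕ n) i → f i ≤ᵥ ⨆ f
≤-⨆ f zero = ⊔ᵥ-upperˡ _ _
≤-⨆ f (suc i) = ≤ᵥ-trans (≤-⨆ (λ i → f (suc i)) i) (⊔ᵥ-upperʳ (f zero) _)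

antichain-bounded : ExcludedMiddle 0ℓ → ∀ {n} (S : Vec ℕ n → Set) → Antichain S →
                    ∃ λ B → ∀ {a} → S a → a ≤ᵥ B
antichain-bounded em {zero} S _ = [] , λ { {[]} _ → [] }
antichain-bounded em {suc n} S anti with em {∃ S}
... | no ∄S = replicate (suc n) 0 , λ {a} a∈S → contradiction (a , a∈S) ∄S
... | yes (a₀ , a₀∈S) = a₀ ⊔ᵥ ⨆ column , bounded
  where
  -- Any other a ∈ S has a coordinate i with aᵢ < a₀ᵢ, so it lies in one of the finitely many
  -- slices {aᵢ = k} with k < a₀ᵢ, each of which is an antichain in one dimension less.
  Slice : Fin (suc n) → ℕ → Vec ℕ n → Set
  Slice i k t = S (insertAt t i k)

  slice-antichain : ∀ i k → Antichain (Slice i k)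
  slice-antichain i k {t} {t'} st st' t≤t' = begin
    t                             ≡⟨ VecP.removeAt-insertAt t i k ⟨
    removeAt (insertAt t i k) i   ≡⟨ cong (λ a → removeAt a i) (anti st st' (insertAt-mono i k t≤t')) ⟩
    removeAt (insertAt t' i k) i  ≡⟨ VecP.removeAt-insertAt t' i k ⟩
    t'                            ∎
    where open ≡-Reasoning

  sliceBound : Fin (suc n) → ℕ → Vec ℕ n
  sliceBound i k = proj₁ (antichain-bounded em (Slice i k) (slice-antichain i k))

  column : Fin (suc n) → Vec ℕ (suc n)
  column i = ⨆ λ (k : Fin (lookup a₀ i)) → insertAt (sliceBound i (toℕ k)) i (toℕ k)

  bounded : ∀ {a} → S a → a ≤ᵥ a₀ ⊔ᵥ ⨆ column
  bounded {a} a∈S with Pointwise.decidable ℕP._≤?_ a₀ a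
  ... | yes a₀≤a = subst (_≤ᵥ _) (anti a₀∈S a∈S a₀≤a) (⊔ᵥ-upperˡ a₀ _)
  ... | no a₀≰a with ≰ᵥ⇒∃> a₀≰a
  ...   | i , aᵢ<a₀ᵢ =
    ≤ᵥ-trans a≤slice (≤ᵥ-trans (≤-⨆ _ (fromℕ< aᵢ<a₀ᵢ)) (≤ᵥ-trans (≤-⨆ column i) (⊔ᵥ-upperʳ a₀ _)))
    where
    aᵢ : ℕ
    aᵢ = lookup a i
    in-slice : Slice i aᵢ (removeAt a i)
    in-slice = subst S (sym (VecP.insertAt-removeAt a i)) a∈S
    a≤slice : a ≤ᵥ insertAt (sliceBound i (toℕ (fromℕ< aᵢ<a₀ᵢ))) i (toℕ (fromℕ< aᵢ<a₀ᵢ))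
    a≤slice = subst (λ k → a ≤ᵥ insertAt (sliceBound i k) i k) (sym (FinP.toℕ-fromℕ< aᵢ<a₀ᵢ))
      (subst (_≤ᵥ insertAt (sliceBound i aᵢ) i aᵢ) (VecP.insertAt-removeAt a i)
        (insertAt-mono i aᵢ (proj₂ (antichain-bounded em (Slice i aᵢ) (slice-antichain i aᵢ)) in-slice)))

-- A peak c ← P → g with u = P - c and v = P - g is the translate by γ = P - z of
-- x^(u,v) ← z → y^(u,v), where z = z^(u,v) ≤ P.
module PeakDecomposition {n} (P c g : Vec ℕ n) where
  u v : Vec ℤ n
  u = toℤᵥ P -ᵥ toℤᵥ c
  v = toℤᵥ P -ᵥ toℤᵥ g

  z γ : Vec ℕ n
  z = zUV u v
  γ = P ⊖ z

  z≤P : z ≤ᵥ P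
  z≤P rewrite ⁺-toℤᵥ-difference P c | ⁺-toℤᵥ-difference P g = ⊔ᵥ-lub (⊖-≤ P c) (⊖-≤ P g)

  z⊕γ≡P : z ⊕ γ ≡ P
  z⊕γ≡P = trans (VecP.zipWith-comm ℕP.+-comm z γ) (⊖-⊕-cancel z≤P)

  private
    translate : ∀ c → let w = toℤᵥ P -ᵥ toℤᵥ c in w ⁺ ≤ᵥ z → z ⊖ w ⁺ ⊕ w ⁻ ⊕ γ ≡ c
    translate c w⁺≤z = toℤᵥ-injective (begin
      toℤᵥ (z ⊖ w ⁺ ⊕ w ⁻ ⊕ γ)              ≡⟨ toℤᵥ-⊕ (z ⊖ w ⁺ ⊕ w ⁻) γ ⟩
      toℤᵥ (z ⊖ w ⁺ ⊕ w ⁻) +ᵥ toℤᵥ γ        ≡⟨ cong₂ _+ᵥ_ (toℤᵥ-[⊖⁺]⊕⁻ w w⁺≤z) (toℤᵥ-⊖ z≤P) ⟩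
      (toℤᵥ z -ᵥ w) +ᵥ (toℤᵥ P -ᵥ toℤᵥ z)  ≡⟨ -ᵥ-+ᵥ-regroup (toℤᵥ z) (toℤᵥ P) (toℤᵥ c) ⟩
      toℤᵥ c                                ∎)
      where
      open ≡-Reasoning
      w : Vec ℤ n
      w = toℤᵥ P -ᵥ toℤᵥ c

  xUV⊕γ≡c : xUV u v ⊕ γ ≡ c
  xUV⊕γ≡c = translate c (⊔ᵥ-upperˡ (u ⁺) (v ⁺))

  yUV⊕γ≡g : yUV u v ⊕ γ ≡ g
  yUV⊕γ≡g = translate g (⊔ᵥ-upperʳ (u ⁺) (v ⁺))

module Fibers {n : ℕ} {L : Vec ℤ n → Set} (isL : IsLattice L) where
  open IsLattice isL

  private variable
    u v w b : Vec ℤ n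
    a s x y γ : Vec ℕ n

  infix 4 _∼_
  _∼_ : Vec ℤ n → Vec ℤ n → Set
  u ∼ v = L (u -ᵥ v)

  ∼-refl : u ∼ u
  ∼-refl {u} = subst L (sym (-ᵥ-self u)) zero∈

  ∼-sym : u ∼ v → v ∼ u
  ∼-sym {u} {v} u∼v = subst L (-ᵥ-anticomm u v) (neg-closed _ u∼v)

  ∼-trans : u ∼ v → v ∼ w → u ∼ w
  ∼-trans {u} {v} {w} u∼v v∼w = subst L (-ᵥ-telescope u v w) (+-closed _ _ u∼v v∼w)

  -ᵥ-∼ : L w → (u -ᵥ w) ∼ u
  -ᵥ-∼ {w} {u} w∈L = ∼-sym (subst L (sym (-ᵥ-involutive u w)) w∈L)

  -- F b x unfolds to toℤᵥ x ∼ b.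
  F : Vec ℤ n → Vec ℕ n → Set
  F b = InFiber L b

  ∈F-self : ∀ x → F (toℤᵥ x) x
  ∈F-self x = ∼-refl

  ∈F-rebase : F b x → F b y → F (toℤᵥ x) y
  ∈F-rebase x∈F y∈F = ∼-trans y∈F (∼-sym x∈F)

  ∈F-unrebase : F b x → F (toℤᵥ x) y → F b y
  ∈F-unrebase x∈F y∈Fx = ∼-trans y∈Fx x∈F

  ∈F-shift : F (toℤᵥ s) x → F b (s ⊕ γ) → F b (x ⊕ γ)
  ∈F-shift {s} {x} {γ = γ} x∈Fs s+γ∈F = ∼-trans (subst L (sym (toℤᵥ-⊕-difference x s γ)) x∈Fs) s+γ∈F

  ∈F-unshift : F b (x ⊕ γ) → F b (s ⊕ γ) → F (toℤᵥ s) x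
  ∈F-unshift {x = x} {γ} {s} x+γ∈F s+γ∈F = subst L (toℤᵥ-⊕-difference x s γ) (∼-trans x+γ∈F (∼-sym s+γ∈F))

  ∈F-difference : F b x → L (toℤᵥ x -ᵥ toℤᵥ y) → F b y
  ∈F-difference x∈F x-y∈L = ∼-trans (∼-sym x-y∈L) x∈F

  xUV∈F : ∀ u v → L u → F (toℤᵥ (zUV u v)) (xUV u v)
  xUV∈F u v u∈L = subst (_∼ toℤᵥ (zUV u v)) (sym (toℤᵥ-xUV u v)) (-ᵥ-∼ u∈L)

  yUV∈F : ∀ u v → L v → F (toℤᵥ (zUV u v)) (yUV u v)
  yUV∈F u v v∈L = subst (_∼ toℤᵥ (zUV u v)) (sym (toℤᵥ-yUV u v)) (-ᵥ-∼ v∈L)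

  fiber-antichain : MeetsOrthantTrivially L → Antichain (F b)
  fiber-antichain orth {a} {y} a∈F y∈F a≤y = begin
    a                         ≡⟨ VecP.zipWith-identityˡ ℕP.+-identityˡ a ⟨
    replicate n 0 ⊕ a         ≡⟨ cong (_⊕ a) y-a≡0 ⟨
    y ⊖ a ⊕ a                 ≡⟨ ⊖-⊕-cancel a≤y ⟩
    y                         ∎
    where
    open ≡-Reasoning
    y-a≡0 : y ⊖ a ≡ replicate n 0
    y-a≡0 = orth (y ⊖ a) (subst L (sym (toℤᵥ-⊖ a≤y)) (∈F-rebase a∈F y∈F))

module TermOrder {n : ℕ} {L : Vec ℤ n → Set} (isL : IsLattice L)
                 {_≻_ : Vec ℕ n → Vec ℕ n → Set} (TO : IsTermOrdering L _≻_) where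
  open Fibers isL
  open IsTermOrdering TO using (irrefl; total; least; additive)

  private variable
    b : Vec ℤ n
    x y z γ : Vec ℕ n

  infix 4 _≽_
  _≽_ : Vec ℕ n → Vec ℕ n → Set
  x ≽ y = x ≡ y ⊎ x ≻ y

  ≻-irrefl : ∀ x → ¬ x ≻ x
  ≻-irrefl x = irrefl (toℤᵥ x) x (∈F-self x)

  ≻-trans : F b x → F b y → F b z → x ≻ y → y ≻ z → x ≻ z
  ≻-trans = IsTermOrdering.trans TO _ _ _ _

  ≻-asym : F b x → F b y → x ≻ y → ¬ y ≻ x
  ≻-asym {x = x} x∈F y∈F x≻y y≻x = ≻-irrefl x (≻-trans x∈F y∈F x∈F x≻y y≻x)

  ≽-refl : x ≽ x
  ≽-refl = inj₁ refl

  ≽-≻-trans : F b x → F b y → F b z → x ≽ y → y ≻ z → x ≻ z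
  ≽-≻-trans _ _ _ (inj₁ refl) y≻z = y≻z
  ≽-≻-trans x∈F y∈F z∈F (inj₂ x≻y) y≻z = ≻-trans x∈F y∈F z∈F x≻y y≻z

  ≽-trans : F b x → F b y → F b z → x ≽ y → y ≽ z → x ≽ z
  ≽-trans _ _ _ x≽y (inj₁ refl) = x≽y
  ≽-trans x∈F y∈F z∈F x≽y (inj₂ y≻z) = inj₂ (≽-≻-trans x∈F y∈F z∈F x≽y y≻z)

  ≽⇒≯ : F b x → F b y → x ≽ y → ¬ y ≻ x
  ≽⇒≯ {x = x} _ _ (inj₁ refl) = ≻-irrefl x
  ≽⇒≯ x∈F y∈F (inj₂ x≻y) = ≻-asym x∈F y∈F x≻y

  ≽-shift : x ≽ y → x ⊕ γ ≽ y ⊕ γ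
  ≽-shift (inj₁ refl) = inj₁ refl
  ≽-shift (inj₂ x≻y) = inj₂ (additive _ _ _ x≻y)

  compare : F b x → F b y → x ≽ y ⊎ y ≻ x
  compare {b} {x} {y} x∈F y∈F with VecP.≡-dec ℕP._≟_ x y
  ... | yes x≡y = inj₁ (inj₁ x≡y)
  ... | no x≢y with total b x y x∈F y∈F x≢y
  ...   | inj₁ x≻y = inj₁ (inj₂ x≻y)
  ...   | inj₂ y≻x = inj₂ y≻x

  -- `least` applies to arbitrary predicates, which makes it classical as soon as the fiber has two elements:
  -- the least element of {x} ∪ {y | P} is y exactly when P holds.
  excludedMiddle : F b x → F b y → x ≻ y → ExcludedMiddle 0ℓ
  excludedMiddle {b} {x} {y} x∈F y∈F x≻y {P} with least b (λ w → w ≡ x ⊎ (w ≡ y × P)) (x , x∈F , inj₁ refl)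
  ... | _ , _ , inj₂ (_ , p) , _ = yes p
  ... | _ , _ , inj₁ refl , minimal = no λ p → ≽⇒≯ y∈F x∈F (minimal y y∈F (inj₂ (refl , p))) x≻y

  -- Take m least with P m → P x; everything below m satisfies P, as otherwise it would satisfy P y → P x.
  ≻-rec : (P : Vec ℕ n → Set) → (∀ {x} → F b x → (∀ {y} → F b y → x ≻ y → P y) → P x) →
          ∀ {x} → F b x → P x
  ≻-rec {b} P step {x} x∈F with least b (λ m → P m → P x) (x , x∈F , λ Px → Px)
  ... | m , m∈F , Pm⇒Px , minimal = Pm⇒Px (step m∈F below)
    where
    below : ∀ {y} → F b y → m ≻ y → P y
    below {y} y∈F m≻y with excludedMiddle m∈F y∈F m≻y {P y}
    ... | yes Py = Py
    ... | no ¬Py = contradiction m≻y (≽⇒≯ y∈F m∈F (minimal y y∈F (λ Py → contradiction Py ¬Py)))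

  least-element : F b x → ∃ λ m → IsMinimal L _≻_ b m
  least-element {b} {x} x∈F with least b (λ _ → ⊤) (x , x∈F , tt)
  ... | m , m∈F , _ , minimal = m , m∈F , λ y y∈F → minimal y y∈F tt

module Moves {n : ℕ} {L : Vec ℤ n → Set} (isL : IsLattice L)
             {_≻_ : Vec ℕ n → Vec ℕ n → Set} (TO : IsTermOrdering L _≻_)
             {G : Vec ℤ n → Set} (G⊆L≻ : ∀ u → G u → InL≻ L _≻_ u) where
  open Fibers isL
  open TermOrder isL TO
  open IsTermOrdering TO using (additive)

  private variable
    b : Vec ℤ n
    c d e g x y P γ : Vec ℕ n

  -- Edge G x y unfolds to Move x y ⊎ Move y x.
  Move : Vec ℕ n → Vec ℕ n → Set
  Move x y = G (toℤᵥ x -ᵥ toℤᵥ y)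

  Moves : Vec ℕ n → Vec ℕ n → Set
  Moves = Star Move

  Joinable : Vec ℕ n → Vec ℕ n → Set
  Joinable x y = ∃ λ e → Moves x e × Moves y e

  move⇒≻ : Move x y → x ≻ y
  move⇒≻ {x} {y} x⟶y = subst₂ _≻_ (⊖-⊕-⊓ᵥˡ x y) (⊖-⊕-⊓ᵥʳ x y)
    (additive _ _ (x ⊓ᵥ y) (subst₂ _≻_ (⁺-toℤᵥ-difference x y) (⁻-toℤᵥ-difference x y) (proj₂ (G⊆L≻ _ x⟶y))))

  ∈F-move : F b x → Move x y → F b y
  ∈F-move x∈F x⟶y = ∈F-difference x∈F (proj₁ (G⊆L≻ _ x⟶y))

  ∈F-moves : F b x → Moves x y → F b y
  ∈F-moves x∈F ε = x∈F
  ∈F-moves x∈F (x⟶ ◅ ⟶y) = ∈F-moves (∈F-move x∈F x⟶) ⟶y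

  move-shift : Move x y → Move (x ⊕ γ) (y ⊕ γ)
  move-shift {x} {y} {γ} = subst G (sym (toℤᵥ-⊕-difference x y γ))

  edge-shift : Edge G x y → Edge G (x ⊕ γ) (y ⊕ γ)
  edge-shift (inj₁ x⟶y) = inj₁ (move-shift x⟶y)
  edge-shift (inj₂ y⟶x) = inj₂ (move-shift y⟶x)

  moves-shift : Moves x y → Moves (x ⊕ γ) (y ⊕ γ)
  moves-shift {γ = γ} = gmap (_⊕ γ) move-shift

  joinable-shift : Joinable x y → Joinable (x ⊕ γ) (y ⊕ γ)
  joinable-shift (e , x↠e , y↠e) = _ , moves-shift x↠e , moves-shift y↠e

  joinable-moves : Moves c x → Moves d y → Joinable x y → Joinable c d
  joinable-moves c↠x d↠y (e , x↠e , y↠e) = e , c↠x ◅◅ x↠e , d↠y ◅◅ y↠e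

  FiberEdge : Vec ℤ n → Vec ℕ n → Vec ℕ n → Set
  FiberEdge b x y = F b x × F b y × Edge G x y

  EdgeBelow : Vec ℤ n → Vec ℕ n → Vec ℕ n → Vec ℕ n → Set
  EdgeBelow b P x y = FiberEdge b x y × P ≽ x × P ≽ y

  edgeBelow-sym : EdgeBelow b P x y → EdgeBelow b P y x
  edgeBelow-sym ((x∈F , y∈F , edge) , P≽x , P≽y) = (y∈F , x∈F , swap edge) , P≽y , P≽x

  moves-below : F b P → F b x → P ≽ x → Moves x y → Star (EdgeBelow b P) x y
  moves-below P∈F x∈F P≽x ε = ε
  moves-below P∈F x∈F P≽x (x⟶z ◅ z↠y) =
    ((x∈F , z∈F , inj₁ x⟶z) , P≽x , P≽z) ◅ moves-below P∈F z∈F P≽z z↠y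
    where
    z∈F : F _ _
    z∈F = ∈F-move x∈F x⟶z
    P≽z : _ ≽ _
    P≽z = inj₂ (≽-≻-trans P∈F x∈F z∈F P≽x (move⇒≻ x⟶z))

  wedge : F b P → Moves P x → Moves P y → Star (EdgeBelow b P) x y
  wedge P∈F P↠x P↠y = reverse edgeBelow-sym (moves-below P∈F P∈F ≽-refl P↠x) ◅◅ moves-below P∈F P∈F ≽-refl P↠y

  Steps : (Vec ℕ n → Vec ℕ n → Set) → Path L G b x y → Set
  Steps R p = ∀ j → R (vtx p (inject₁ j)) (vtx p (suc j))

  start∈F : Path L G b x y → F b x
  start∈F p = subst (F _) (start p) (inF p zero)

  end∈F : Path L G b x y → F b y
  end∈F p = subst (F _) (end p) (inF p (fromℕ (len p)))

  path⇒star : ∀ {R} (p : Path L G b x y) → Steps R p → Star R x y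
  path⇒star {R = R} p steps = subst₂ (Star R) (start p) (end p) (walk (len p) (vtx p) steps)
    where
    walk : ∀ k (f : Fin (suc k) → Vec ℕ n) → (∀ j → R (f (inject₁ j)) (f (suc j))) →
           Star R (f zero) (f (fromℕ k))
    walk zero f _ = ε
    walk (suc k) f steps = steps zero ◅ walk k (λ j → f (suc j)) (λ j → steps (suc j))

  star⇒path : ∀ {R} → (∀ {s t} → R s t → Edge G s t) → (∀ {s t} → F b s → R s t → F b t) →
              F b x → Star R x y → Σ (Path L G b x y) (Steps R)
  star⇒path {x = x} _ _ x∈F ε =
    record { len = 0 ; vtx = λ _ → x ; inF = λ _ → x∈F ; adj = λ () ; start = refl ; end = refl } , λ ()
  star⇒path {b = b} {x = x} {R = R} edge stay x∈F (x→ ◅ →y) with star⇒path edge stay (stay x∈F x→) →y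
  ... | p , steps = record { len = suc (len p) ; vtx = vtx′ ; inF = inF′ ; adj = λ j → edge (steps′ j)
                           ; start = refl ; end = end p } , steps′
    where
    vtx′ : Fin (suc (suc (len p))) → Vec ℕ n
    vtx′ zero = x
    vtx′ (suc j) = vtx p j
    inF′ : ∀ j → F b (vtx′ j)
    inF′ zero = x∈F
    inF′ (suc j) = inF p j
    steps′ : ∀ j → R (vtx′ (inject₁ j)) (vtx′ (suc j))
    steps′ zero = subst (R x) (sym (start p)) x→
    steps′ (suc j) = steps j

  decreasing⇒moves : (p : Path L G b x y) → Decreasing _≻_ p → Moves x y
  decreasing⇒moves p decreasing = path⇒star p λ j → oriented (inF p _) (inF p _) (adj p j) (decreasing j)
    where
    oriented : F b c → F b d → Edge G c d → c ≻ d → Move c d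
    oriented _ _ (inj₁ c⟶d) _ = c⟶d
    oriented c∈F d∈F (inj₂ d⟶c) c≻d = contradiction (move⇒≻ d⟶c) (≻-asym c∈F d∈F c≻d)

  moves⇒decreasing : F b x → Moves x y → Σ (Path L G b x y) (Decreasing _≻_)
  moves⇒decreasing x∈F x↠y with star⇒path inj₁ ∈F-move x∈F x↠y
  ... | p , steps = p , λ j → move⇒≻ (steps j)

  BelowEnds : Vec ℕ n → Vec ℕ n → Vec ℕ n → Set
  BelowEnds x y t = x ≽ t ⊎ y ≽ t

  ValleyEdge : Vec ℤ n → Vec ℕ n → Vec ℕ n → Vec ℕ n → Vec ℕ n → Set
  ValleyEdge b x y s t = FiberEdge b s t × BelowEnds x y s × BelowEnds x y t

  belowEnds⇒reduction : (p : Path L G b x y) → (∀ j → BelowEnds x y (vtx p j)) → Reduction _≻_ p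
  belowEnds⇒reduction p below (j , _ , _ , t≻x , t≻y) with below j
  ... | inj₁ x≽t = ≽⇒≯ (start∈F p) (inF p j) x≽t (subst (vtx p j ≻_) (start p) t≻x)
  ... | inj₂ y≽t = ≽⇒≯ (end∈F p) (inF p j) y≽t (subst (vtx p j ≻_) (end p) t≻y)

  reduction⇒belowEnds : (p : Path L G b x y) → Reduction _≻_ p → ∀ j → BelowEnds x y (vtx p j)
  reduction⇒belowEnds {x = x} {y} p reduction j with compare (start∈F p) (inF p j) | compare (end∈F p) (inF p j)
  ... | inj₁ x≽t | _ = inj₁ x≽t
  ... | inj₂ _ | inj₁ y≽t = inj₂ y≽t
  ... | inj₂ t≻x | inj₂ t≻y = contradiction (t≻x , t≻y) (interior j)
    where
    interior : ∀ j → ¬ (vtx p j ≻ x × vtx p j ≻ y)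
    interior zero (t≻x , _) = ≻-irrefl x (subst (_≻ x) (start p) t≻x)
    interior (suc j) (t≻x , t≻y) with toℕ (suc j) ℕP.≟ len p
    ... | yes j≡len = ≻-irrefl y (subst (_≻ y) (trans (cong (vtx p) (FinP.toℕ-injective
                        (trans j≡len (sym (FinP.toℕ-fromℕ (len p)))))) (end p)) t≻y)
    ... | no j≢len = reduction (suc j , s≤s z≤n , ℕP.≤∧≢⇒< (ℕ.s≤s⁻¹ (FinP.toℕ<n (suc j))) j≢len
                               , subst (vtx p (suc j) ≻_) (sym (start p)) t≻x
                               , subst (vtx p (suc j) ≻_) (sym (end p)) t≻y)

  reductionPath⇒valley : (p : Path L G b x y) → Reduction _≻_ p → Star (ValleyEdge b x y) x y
  reductionPath⇒valley p reduction = path⇒star p λ j → (inF p _ , inF p _ , adj p j) , onEnds _ , onEnds _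
    where
    onEnds : ∀ j → BelowEnds _ _ (vtx p j)
    onEnds = reduction⇒belowEnds p reduction

  valley⇒reductionPath : F b x → Star (ValleyEdge b x y) x y → Σ (Path L G b x y) (Reduction _≻_)
  valley⇒reductionPath {b} {x} {y} x∈F valley = p , belowEnds⇒reduction p onEnds
    where
    path : Σ (Path L G b x y) (Steps (ValleyEdge b x y))
    path = star⇒path (λ ((_ , _ , s~t) , _) → s~t) (λ _ ((_ , t∈F , _) , _) → t∈F) x∈F valley
    p : Path L G b x y
    p = proj₁ path
    onEnds : ∀ j → BelowEnds x y (vtx p j)
    onEnds zero = inj₁ (inj₁ (sym (start p)))
    onEnds (suc j) = proj₂ (proj₂ (proj₂ path j))

  joinable⇒valley : F b x → F b y → Joinable x y → Star (ValleyEdge b x y) x y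
  joinable⇒valley x∈F y∈F (e , x↠e , y↠e) =
    gmap id (relabel inj₁) (moves-below x∈F x∈F ≽-refl x↠e) ◅◅
    gmap id (relabel inj₂) (reverse edgeBelow-sym (moves-below y∈F y∈F ≽-refl y↠e))
    where
    relabel : ∀ {b x y Q s t} → (∀ {t} → Q ≽ t → BelowEnds x y t) → EdgeBelow b Q s t → ValleyEdge b x y s t
    relabel below (s~t , Q≽s , Q≽t) = s~t , below Q≽s , below Q≽t

  ConfluentBelow : Vec ℤ n → Vec ℕ n → Set
  ConfluentBelow b P = ∀ {c d} → Star (EdgeBelow b P) c d → Joinable c d

  PeaksJoinable : Vec ℕ n → Set
  PeaksJoinable P = ∀ {c g} → Move P c → Move P g → Joinable c g

  -- Newman's lemma, by well-founded induction on the height P of a conversion.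
  peak-reduction : (∀ {P} → F b P → (∀ {Q} → F b Q → P ≻ Q → ConfluentBelow b Q) → PeaksJoinable P) →
                   ∀ {P} → F b P → ConfluentBelow b P
  peak-reduction {b} peaks = ≻-rec (ConfluentBelow b) join
    where
    module _ {P} (P∈F : F b P) (ih : ∀ {Q} → F b Q → P ≻ Q → ConfluentBelow b Q) where
      peak : Move P c → Moves P e → Joinable c e
      peak P⟶c ε = _ , ε , P⟶c ◅ ε
      peak P⟶c (P⟶g ◅ g↠e) with peaks P∈F ih P⟶c P⟶g
      ... | f , c↠f , g↠f = joinable-moves c↠f ε (ih g∈F (move⇒≻ P⟶g) (wedge g∈F g↠f g↠e))
        where
        g∈F : F b _
        g∈F = ∈F-move P∈F P⟶g

      step : EdgeBelow b P c d → Joinable d e → Joinable c e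
      step ((_ , _ , inj₁ c⟶d) , _) (f , d↠f , e↠f) = f , c⟶d ◅ d↠f , e↠f
      step ((_ , d∈F , inj₂ d⟶c) , _ , inj₂ P≻d) (f , d↠f , e↠f) =
        joinable-moves ε e↠f (ih d∈F P≻d (wedge d∈F (d⟶c ◅ ε) d↠f))
      step ((_ , _ , inj₂ P⟶c) , _ , inj₁ refl) (f , P↠f , e↠f) = joinable-moves ε e↠f (peak P⟶c P↠f)

      join : ConfluentBelow b P
      join ε = _ , ε , ε
      join (c~d ◅ d~e) = step c~d (join d~e)

  conversion-bounded : F b c → Star (FiberEdge b) c d → ∃ λ Q → F b Q × Q ≽ c × Star (EdgeBelow b Q) c d
  conversion-bounded c∈F ε = _ , c∈F , ≽-refl , ε
  conversion-bounded {b} {c} c∈F (c~c₁@(_ , c₁∈F , _) ◅ c₁~d) with conversion-bounded c₁∈F c₁~d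
  ... | Q , Q∈F , Q≽c₁ , below with compare c∈F Q∈F
  ...   | inj₁ c≽Q = c , c∈F , ≽-refl , (c~c₁ , ≽-refl , ≽-trans c∈F Q∈F c₁∈F c≽Q Q≽c₁) ◅ gmap id raise below
    where
    raise : EdgeBelow b Q x y → EdgeBelow b c x y
    raise (x~y@(x∈F , y∈F , _) , Q≽x , Q≽y) = x~y , ≽-trans c∈F Q∈F x∈F c≽Q Q≽x , ≽-trans c∈F Q∈F y∈F c≽Q Q≽y
  ...   | inj₂ Q≻c = Q , Q∈F , inj₂ Q≻c , (c~c₁ , inj₂ Q≻c , Q≽c₁) ◅ below

  conversion⇒joinable : (∀ {P} → F b P → (∀ {Q} → F b Q → P ≻ Q → ConfluentBelow b Q) → PeaksJoinable P) →
                        F b c → Star (FiberEdge b) c d → Joinable c d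
  conversion⇒joinable peaks c∈F c~d with conversion-bounded c∈F c~d
  ... | Q , Q∈F , _ , below = peak-reduction peaks Q∈F below

module GroebnerCriterion {n : ℕ} {L : Vec ℤ n → Set} (isL : IsLattice L)
                         {_≻_ : Vec ℕ n → Vec ℕ n → Set} (TO : IsTermOrdering L _≻_)
                         {G : Vec ℤ n → Set} (G⊆L≻ : ∀ u → G u → InL≻ L _≻_ u) where
  open Fibers isL
  open TermOrder isL TO
  open Moves isL TO G⊆L≻

  private variable
    b : Vec ℤ n
    B c g x y P : Vec ℕ n

  ReductionPath : Vec ℤ n → Vec ℤ n → Set
  ReductionPath u v = Σ (Path L G (toℤᵥ (zUV u v)) (xUV u v) (yUV u v)) (Reduction _≻_)

  groebner⇒reductionPath : IsGroebnerBasis L _≻_ G → ∀ u v → G u → G v → ReductionPath u v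
  groebner⇒reductionPath (_ , decreasing) u v u∈G v∈G =
    valley⇒reductionPath X∈F (joinable⇒valley X∈F Y∈F (m , descend X∈F , descend Y∈F))
    where
    z : Vec ℤ n
    z = toℤᵥ (zUV u v)
    X∈F : F z (xUV u v)
    X∈F = xUV∈F u v (proj₁ (G⊆L≻ u u∈G))
    Y∈F : F z (yUV u v)
    Y∈F = yUV∈F u v (proj₁ (G⊆L≻ v v∈G))
    minimum : ∃ λ m → IsMinimal L _≻_ z m
    minimum = least-element X∈F
    m : Vec ℕ n
    m = proj₁ minimum
    descend : ∀ {w} → F z w → Moves w m
    descend {w} w∈F with decreasing w m (∈F-rebase w∈F (proj₁ (proj₂ minimum)) ,
                                         λ y y∈F → proj₂ (proj₂ minimum) y (∈F-unrebase w∈F y∈F))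
    ... | q , q↓ = decreasing⇒moves q q↓

  module Converse (orth : MeetsOrthantTrivially L) (gen : IsGenerating L G)
                  (condition : ∀ u v → G u → G v → ¬ Criterion2 L _≻_ G u v → ReductionPath u v) where

    Confluent : Vec ℤ n → Set
    Confluent b = ∀ {c d} → F b c → F b d → Joinable c d

    BoundedFiber : Vec ℤ n → Vec ℕ n → Set
    BoundedFiber b B = ∀ {a} → F b a → a ≤ᵥ B

    SmallerFibersConfluent : Vec ℕ n → Set
    SmallerFibersConfluent B = ∀ {B'} → sum B' < sum B → ∀ {b'} → BoundedFiber b' B' → Confluent b'

    -- Removing the common part e = x ⊓ y ≠ 0 lands in a fiber bounded by B - e.
    suppMeet⇒joinable : BoundedFiber b B → SmallerFibersConfluent B →
                        F b x → F b y → SuppMeet x y → Joinable x y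
    suppMeet⇒joinable {b} {B} {x} {y} bounded smaller x∈F y∈F (j , xⱼ≢0 , yⱼ≢0) =
      subst₂ Joinable (⊖-⊕-cancel e≤x) (⊖-⊕-cancel e≤y)
        (joinable-shift (smaller (sum-⊖-< e≤B j 0<eⱼ) a-bounded (∈F-self a) a'∈F))
      where
      e a a' : Vec ℕ n
      e = x ⊓ᵥ y
      a = x ⊖ e
      a' = y ⊖ e
      e≤x : e ≤ᵥ x
      e≤x = ⊓ᵥ-lowerˡ x y
      e≤y : e ≤ᵥ y
      e≤y = ⊓ᵥ-lowerʳ x y
      e≤B : e ≤ᵥ B
      e≤B = ≤ᵥ-trans e≤x (bounded x∈F)
      0<eⱼ : 0 < lookup e j
      0<eⱼ = subst (0 <_) (sym (VecP.lookup-zipWith _⊓_ j x y))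
                   (ℕP.⊓-glb (ℕP.n≢0⇒n>0 xⱼ≢0) (ℕP.n≢0⇒n>0 yⱼ≢0))
      a⊕e∈F : F b (a ⊕ e)
      a⊕e∈F = subst (F b) (sym (⊖-⊕-cancel e≤x)) x∈F
      a'∈F : F (toℤᵥ a) a'
      a'∈F = ∈F-unshift (subst (F b) (sym (⊖-⊕-cancel e≤y)) y∈F) a⊕e∈F
      a-bounded : BoundedFiber (toℤᵥ a) (B ⊖ e)
      a-bounded w∈F = ⊕-≤⇒≤-⊖ (bounded (∈F-shift w∈F a⊕e∈F))

    criterion2⇒joinable : BoundedFiber b B → SmallerFibersConfluent B → F b P → Move P c → Move P g →
                          Criterion2 L _≻_ G (toℤᵥ P -ᵥ toℤᵥ c) (toℤᵥ P -ᵥ toℤᵥ g) → Joinable c g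
    criterion2⇒joinable {P = P} {c} {g} bounded smaller P∈F P⟶c P⟶g
                        (x' , y' , _ , _ , (p , p↓) , (q , q↓) , shared) =
      joinable-moves c↠ g↠ (suppMeet⇒joinable bounded smaller
                              (∈F-moves (∈F-move P∈F P⟶c) c↠) (∈F-moves (∈F-move P∈F P⟶g) g↠)
                              (suppMeet-⊕ {x = x'} {y'} γ shared))
      where
      open PeakDecomposition P c g
      c↠ : Moves c (x' ⊕ γ)
      c↠ = subst (λ w → Moves w (x' ⊕ γ)) xUV⊕γ≡c (moves-shift (decreasing⇒moves p p↓))
      g↠ : Moves g (y' ⊕ γ)
      g↠ = subst (λ w → Moves w (y' ⊕ γ)) yUV⊕γ≡g (moves-shift (decreasing⇒moves q q↓))

    -- A reduction path stays below one of its ends, so its translate stays below the larger of c, g.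
    reductionPath⇒joinable : F b P → (∀ {Q} → F b Q → P ≻ Q → ConfluentBelow b Q) → Move P c → Move P g →
                             ReductionPath (toℤᵥ P -ᵥ toℤᵥ c) (toℤᵥ P -ᵥ toℤᵥ g) → Joinable c g
    reductionPath⇒joinable {b} {P} {c} {g} P∈F ih P⟶c P⟶g (r , reduction) = belowLarger (compare c∈F g∈F)
      where
      open PeakDecomposition P c g
      X Y : Vec ℕ n
      X = xUV u v
      Y = yUV u v
      c∈F : F b c
      c∈F = ∈F-move P∈F P⟶c
      g∈F : F b g
      g∈F = ∈F-move P∈F P⟶g
      z⊕γ∈F : F b (z ⊕ γ)
      z⊕γ∈F = subst (F b) (sym z⊕γ≡P) P∈F

      translate : ∀ {Q} → F b Q → Q ≽ c → Q ≽ g → Star (EdgeBelow b Q) c g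
      translate {Q} Q∈F Q≽c Q≽g =
        subst₂ (Star (EdgeBelow b Q)) xUV⊕γ≡c yUV⊕γ≡g (gmap (_⊕ γ) shift (reductionPath⇒valley r reduction))
        where
        under : ∀ {t} → F (toℤᵥ z) t → BelowEnds X Y t → Q ≽ t ⊕ γ
        under {t} t∈F (inj₁ X≽t) =
          ≽-trans Q∈F c∈F (∈F-shift t∈F z⊕γ∈F) Q≽c (subst (_≽ t ⊕ γ) xUV⊕γ≡c (≽-shift X≽t))
        under {t} t∈F (inj₂ Y≽t) =
          ≽-trans Q∈F g∈F (∈F-shift t∈F z⊕γ∈F) Q≽g (subst (_≽ t ⊕ γ) yUV⊕γ≡g (≽-shift Y≽t))
        shift : ∀ {s t} → ValleyEdge (toℤᵥ z) X Y s t → EdgeBelow b Q (s ⊕ γ) (t ⊕ γ)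
        shift ((s∈F , t∈F , s~t) , s-below , t-below) =
          (∈F-shift s∈F z⊕γ∈F , ∈F-shift t∈F z⊕γ∈F , edge-shift s~t) , under s∈F s-below , under t∈F t-below

      belowLarger : c ≽ g ⊎ g ≻ c → Joinable c g
      belowLarger (inj₁ c≽g) = ih c∈F (move⇒≻ P⟶c) (translate c∈F ≽-refl c≽g)
      belowLarger (inj₂ g≻c) = ih g∈F (move⇒≻ P⟶g) (translate g∈F (inj₂ g≻c) ≽-refl)

    peaks-joinable : BoundedFiber b B → SmallerFibersConfluent B →
                     F b P → (∀ {Q} → F b Q → P ≻ Q → ConfluentBelow b Q) → PeaksJoinable P
    peaks-joinable {P = P} bounded smaller P∈F ih {c} {g} P⟶c P⟶g
      with excludedMiddle P∈F (∈F-move P∈F P⟶c) (move⇒≻ P⟶c)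
             {Criterion2 L _≻_ G (toℤᵥ P -ᵥ toℤᵥ c) (toℤᵥ P -ᵥ toℤᵥ g)}
    ... | yes criterion2 = criterion2⇒joinable bounded smaller P∈F P⟶c P⟶g criterion2
    ... | no ¬criterion2 = reductionPath⇒joinable P∈F ih P⟶c P⟶g (condition _ _ P⟶c P⟶g ¬criterion2)

    fiber-confluent : ∀ B {b} → BoundedFiber b B → Confluent b
    fiber-confluent = All.wfRec (On.wellFounded sum <-wellFounded) 0ℓ
                        (λ B → ∀ {b} → BoundedFiber b B → Confluent b) step
      where
      step : ∀ B → SmallerFibersConfluent B → ∀ {b} → BoundedFiber b B → Confluent b
      step B smaller {b} bounded {c} {d} c∈F d∈F =
        conversion⇒joinable (peaks-joinable bounded smaller) c∈F (path⇒star p λ j → inF p _ , inF p _ , adj p j)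
        where
        p : Path L G b c d
        p = gen b c d c∈F d∈F

    reductionPaths⇒groebner : IsGroebnerBasis L _≻_ G
    reductionPaths⇒groebner = G⊆L≻ , descend
      where
      descend : ∀ x m → IsMinimal L _≻_ (toℤᵥ x) m → Σ (Path L G (toℤᵥ x) x m) (Decreasing _≻_)
      descend x m (m∈F , minimal) = moves⇒decreasing (∈F-self x) (reach (minimal x (∈F-self x)))
        where
        stuck : ∀ {e} → Moves m e → e ≡ m
        stuck ε = refl
        stuck (m⟶y ◅ _) = contradiction (move⇒≻ m⟶y) (≽⇒≯ y∈F m∈F (minimal _ y∈F))
          where
          y∈F : F (toℤᵥ x) _
          y∈F = ∈F-move m∈F m⟶y
        reach : x ≽ m → Moves x m
        reach (inj₁ refl) = ε
        reach (inj₂ x≻m) with antichain-bounded (excludedMiddle (∈F-self x) m∈F x≻m) (F (toℤᵥ x)) (fiber-antichain orth)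
        ... | B , bounded with fiber-confluent B bounded (∈F-self x) m∈F
        ...   | e , x↠e , m↠e = subst (Moves x) (stuck m↠e) x↠e

lemma25 : (n : ℕ) (L : Vec ℤ n → Set) (_≻_ : Vec ℕ n → Vec ℕ n → Set) (G : Vec ℤ n → Set) →
    IsLattice L → MeetsOrthantTrivially L → IsTermOrdering L _≻_ →
    (∀ u → G u → InL≻ L _≻_ u) → IsGenerating L G →
    IsGroebnerBasis L _≻_ G ⇔
      (∀ u v → G u → G v → ¬ Criterion2 L _≻_ G u v →
        Σ (Path L G (toℤᵥ (zUV u v)) (xUV u v) (yUV u v)) λ p → Reduction _≻_ p)
lemma25 n L _≻_ G isL orth TO G⊆L≻ gen =
  mk⇔ (λ groebner u v u∈G v∈G _ → groebner⇒reductionPath groebner u v u∈G v∈G)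
      (λ condition → Converse.reductionPaths⇒groebner orth gen condition)
  where open GroebnerCriterion isL TO G⊆L≻
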